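{- Let $2\le l\le n$ and let $\alpha$ be a cascading $n$-sequence which is an $l$-plateau. Then no lower subinterval of $\alpha$ whose head is less than $l$ contains an entry that is the first entry of some $l$-lane of $\alpha$.
   Context: An $m$-lower subinterval ($1\le a\le m\le n$) is the tuple $(a,a+1,\ldots,m)$; its head is $a$ and its right endpoint is $m$. An $m$-component is a finite (possibly empty) sequence of $m$-lower subintervals ordered by nonincreasing length; a cascading $n$-sequence is the concatenation of an $n$-component, an $(n-1)$-component, $\ldots$, a $1$-component, regarded both as its list of lower subintervals $I_1,\ldots,I_P$ (left to right) and as the concatenated integer sequence. Lanes: the entries of $\alpha$ are distributed into lanes $L_d(v)$ ($v\in[n]$, $d\ge1$), tuples of entries of value $v$, by processing $I_1,\ldots,I_P$ in order, all lanes initially empty; to process $I_b=(v_1,\ldots,v_s)$: let $d_1$ be the largest $d\ge1$ with $L_d(v_1)$ currently nonempty ($0$ if none) and append the entry $v_1$ of $I_b$ to $L_{d_1+1}(v_1)$; for $k=2,\ldots,s$ in order let $d_k$ be the largest $d$ with $1\le d\le d_{k-1}$ and $|L_d(v_k)|>|L_{d+1}(v_k)|$ (current lengths, $|L|$ the number of entries), or $0$ if none, and append the entry $v_k$ of $I_b$ to $L_{d_k+1}(v_k)$. A nonempty lane $L_d(v)$ is a $v$-lane; it ends at a right endpoint if its last entry is the right endpoint of the lower subinterval containing it. For $2\le m\le n$, $\alpha$ is an $m$-plateau if: (i) for every $i$ with $L_i(m)$ nonempty, $|L_i(m-1)|=|L_i(m)|-1$; (ii) no $(m-1)$-lane ends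 at a right endpoint; (iii) for every $k<m-1$, no $k$-lane ends at a right endpoint. -}

module Defs where

open import Data.Nat using (ℕ; zero; suc; _+_; _∸_; _≤_; _<_; _<ᵇ_; _≡ᵇ_)
open import Data.Bool using (Bool; true; false; if_then_else_)
open import Data.List using (List; []; _∷_; length; last; [_]; _++_)
open import Data.List.Relation.Unary.Linked using (Linked)
open import Data.List.Relation.Unary.All using (All)
open import Data.Maybe using (Maybe; just; nothing)
open import Data.Product using (_×_; _,_; ∃-syntax)
open import Relation.Binary.PropositionalEquality using (_≡_)
open import Relation.Nullary using (¬_)

-- A lower subinterval (a, a+1, ..., m) is represented by the pair (a , m).
Interval : Set
Interval = ℕ × ℕ

Seq : Set
Seq = List Interval

ValidInterval : ℕ → Interval → Set
ValidInterval n (a , m) = 1 ≤ a × a ≤ m × m ≤ n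

-- Consecutive intervals: right endpoints nonincreasing (n-component, then
-- (n-1)-component, ...), and within the same component lengths nonincreasing.
CascOrder : Interval → Interval → Set
CascOrder (a , m) (a' , m') = m' ≤ m × (m' ≡ m → (m' ∸ a') ≤ (m ∸ a))

Cascading : ℕ → Seq → Set
Cascading n α = All (ValidInterval n) α × Linked CascOrder α

-- An entry of α is identified by (b , k): the index b (0-based) of the lower
-- subinterval containing it and its offset k within it (its value is a_b + k).
Entry : Set
Entry = ℕ × ℕ

-- The lanes of a value v: list whose (d-1)-th element is L_d(v); lanes beyond
-- the end of the list are empty.
Lanes : Set
Lanes = List (List Entry)

-- The full lane state: for each value v, its lanes.
State : Set
State = ℕ → Lanes

emptyState : State
emptyState _ = []

-- L_d for d ≥ 1 (L_0 is never used; return empty).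
laneAt : Lanes → ℕ → List Entry
laneAt _ zero = []
laneAt [] (suc d) = []
laneAt (l ∷ ls) (suc zero) = l
laneAt (l ∷ ls) (suc (suc d)) = laneAt ls (suc d)

appendLane : Lanes → ℕ → Entry → Lanes
appendLane ls zero e = ls
appendLane [] (suc zero) e = [ e ] ∷ []
appendLane [] (suc (suc d)) e = [] ∷ appendLane [] (suc d) e
appendLane (l ∷ ls) (suc zero) e = (l ++ [ e ]) ∷ ls
appendLane (l ∷ ls) (suc (suc d)) e = l ∷ appendLane ls (suc d) e

isNonempty : List Entry → Bool
isNonempty [] = false
isNonempty (_ ∷ _) = true

lastNonempty : Lanes → ℕ
lastNonempty [] = zero
lastNonempty (l ∷ ls) with lastNonempty ls
... | suc r = suc (suc r)
... | zero = if isNonempty l then 1 else 0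

searchDown : Lanes → ℕ → ℕ
searchDown ls zero = zero
searchDown ls (suc d) =
  if length (laneAt ls (suc (suc d))) <ᵇ length (laneAt ls (suc d))
  then suc d else searchDown ls d

update : State → ℕ → Lanes → State
update st v ls w = if w ≡ᵇ v then ls else st w

-- process the remaining r entries of interval b, next offset k, next value v,
-- previous lane index dprev = d_{k-1}
processRest : ℕ → ℕ → ℕ → ℕ → ℕ → State → State
processRest b zero k v dprev st = st
processRest b (suc r) k v dprev st =
  let d = searchDown (st v) dprev
  in processRest b r (suc k) (suc v) d
       (update st v (appendLane (st v) (suc d) (b , k)))

processInterval : ℕ → Interval → State → State
processInterval b (a , m) st =
  let d₁ = lastNonempty (st a)
  in processRest b (m ∸ a) 1 (suc a) d₁
       (update st a (appendLane (st a) (suc d₁) (b , 0)))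

processFrom : ℕ → Seq → State → State
processFrom b [] st = st
processFrom b (I ∷ α) st = processFrom (suc b) α (processInterval b I st)

lanesOf : Seq → State
lanesOf α = processFrom 0 α emptyState

nth : {A : Set} → ℕ → List A → Maybe A
nth _ [] = nothing
nth zero (x ∷ _) = just x
nth (suc b) (_ ∷ xs) = nth b xs

EndsAtRightEndpoint : Seq → List Entry → Set
EndsAtRightEndpoint α L =
  ∃[ b ] ∃[ k ] ∃[ a ] ∃[ m ]
    (last L ≡ just (b , k) × nth b α ≡ just (a , m) × a + k ≡ m)

Nonempty : List Entry → Set
Nonempty L = ∃[ e ] ∃[ es ] (L ≡ e ∷ es)

Plateau : Seq → ℕ → Set
Plateau α m =
  (∀ i → 1 ≤ i → Nonempty (laneAt (lanesOf α m) i) →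
      length (laneAt (lanesOf α (m ∸ 1)) i) + 1 ≡ length (laneAt (lanesOf α m) i))
  × (∀ d → 1 ≤ d → Nonempty (laneAt (lanesOf α (m ∸ 1)) d) →
      ¬ EndsAtRightEndpoint α (laneAt (lanesOf α (m ∸ 1)) d))
  × (∀ k → k < m ∸ 1 → ∀ d → 1 ≤ d → Nonempty (laneAt (lanesOf α k) d) →
      ¬ EndsAtRightEndpoint α (laneAt (lanesOf α k) d))

-- Write p = l - 1 and q = l. While the intervals of α still reach q, each of them either has head
-- q, and then its entry q opens a new q-lane, or has head at most p, and then its entries p and q
-- are placed together: searchDown keeps every p-lane no longer than the q-lane with the same index,
-- and #(q-entries) ≤ #(p-entries) + #(nonempty q-lanes), strictly if some q-lane starts in an
-- interval with head below q. After that all intervals end below q (α is cascading), so the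
-- q-lanes are final and the p-lanes only grow. Condition (i) of the plateau says that each nonempty
-- q-lane is one longer than its p-lane, so #(q-entries) equals the number of p-entries in lanes
-- under nonempty q-lanes plus #(nonempty q-lanes), contradicting the strict bound.

module Submission where

open import Defs
open import Data.Nat using (ℕ; zero; suc; _+_; _∸_; _≤_; _<_; _<ᵇ_; _≡ᵇ_; z≤n; s≤s; z<s; _≟_; _≤?_)
open import Data.Nat.Properties
open import Algebra.Properties.CommutativeSemigroup +-commutativeSemigroup using (interchange)
open import Data.Bool using (true; false)
open import Data.Empty using (⊥-elim)
open import Data.List using (List; []; _∷_; length; [_]; _++_; drop; map)
open import Data.Nat.ListAction using (sum)
open import Data.List.Properties using (length-++)
open import Data.List.Relation.Unary.All using (All; []; _∷_)
import Data.List.Relation.Unary.All as All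
open import Data.List.Relation.Unary.Linked using (Linked; [-]; _∷_)
import Data.List.Relation.Unary.Linked as Linked
open import Data.Maybe using (just)
open import Data.Product using (_×_; _,_; proj₁; proj₂; ∃-syntax)
open import Data.Sum using (_⊎_; inj₁; inj₂)
open import Data.Unit using (⊤; tt)
open import Function using (_∘_)
open import Relation.Binary.Definitions using (tri<; tri≈; tri>)
open import Relation.Binary.PropositionalEquality
  using (_≡_; _≢_; refl; sym; trans; cong; cong₂; subst; subst₂; module ≡-Reasoning)
open import Relation.Nullary using (¬_; yes; no)

length-snoc : ∀ (xs : List Entry) x → length (xs ++ [ x ]) ≡ suc (length xs)
length-snoc xs x = trans (length-++ xs) (+-comm (length xs) 1)

laneAt-drop : ∀ ls d → laneAt ls (suc (suc d)) ≡ laneAt (drop 1 ls) (suc d)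
laneAt-drop []       d = refl
laneAt-drop (l ∷ ls) d = refl

laneAt-appendLane-≡ : ∀ ls d e → laneAt (appendLane ls (suc d) e) (suc d) ≡ laneAt ls (suc d) ++ [ e ]
laneAt-appendLane-≡ []       zero    e = refl
laneAt-appendLane-≡ []       (suc d) e = laneAt-appendLane-≡ [] d e
laneAt-appendLane-≡ (l ∷ ls) zero    e = refl
laneAt-appendLane-≡ (l ∷ ls) (suc d) e = laneAt-appendLane-≡ ls d e

laneAt-appendLane-≢ : ∀ ls d e i → i ≢ d → laneAt (appendLane ls d e) i ≡ laneAt ls i
laneAt-appendLane-≢ ls       zero          e i             _   = refl
laneAt-appendLane-≢ ls       (suc d)       e zero          _   = refl
laneAt-appendLane-≢ ls       (suc zero)    e (suc zero)    i≢d = ⊥-elim (i≢d refl)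
laneAt-appendLane-≢ []       (suc zero)    e (suc (suc i)) _   = refl
laneAt-appendLane-≢ (l ∷ ls) (suc zero)    e (suc (suc i)) _   = refl
laneAt-appendLane-≢ []       (suc (suc d)) e (suc zero)    _   = refl
laneAt-appendLane-≢ (l ∷ ls) (suc (suc d)) e (suc zero)    _   = refl
laneAt-appendLane-≢ []       (suc (suc d)) e (suc (suc i)) i≢d =
  laneAt-appendLane-≢ [] (suc d) e (suc i) (i≢d ∘ cong suc)
laneAt-appendLane-≢ (l ∷ ls) (suc (suc d)) e (suc (suc i)) i≢d =
  laneAt-appendLane-≢ ls (suc d) e (suc i) (i≢d ∘ cong suc)

length-laneAt-appendLane : ∀ ls d e →
  length (laneAt (appendLane ls (suc d) e) (suc d)) ≡ suc (length (laneAt ls (suc d)))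
length-laneAt-appendLane ls d e =
  trans (cong length (laneAt-appendLane-≡ ls d e)) (length-snoc (laneAt ls (suc d)) e)

infix 4 _≤ᴸ_

_≤ᴸ_ : Lanes → Lanes → Set
ps ≤ᴸ qs = ∀ d → length (laneAt ps d) ≤ length (laneAt qs d)

≤ᴸ-refl : ∀ {ls} → ls ≤ᴸ ls
≤ᴸ-refl d = ≤-refl

≤ᴸ-trans : ∀ {ps qs rs} → ps ≤ᴸ qs → qs ≤ᴸ rs → ps ≤ᴸ rs
≤ᴸ-trans ps≤qs qs≤rs d = ≤-trans (ps≤qs d) (qs≤rs d)

≤ᴸ-drop : ∀ {ps qs} → ps ≤ᴸ qs → drop 1 ps ≤ᴸ drop 1 qs
≤ᴸ-drop             ps≤qs zero    = z≤n
≤ᴸ-drop {ps} {qs} ps≤qs (suc d) =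
  subst₂ _≤_ (cong length (laneAt-drop ps d)) (cong length (laneAt-drop qs d)) (ps≤qs (suc (suc d)))

appendLane-grows : ∀ ls d e → ls ≤ᴸ appendLane ls d e
appendLane-grows ls zero    e i = ≤-refl
appendLane-grows ls (suc d) e i with i ≟ suc d
... | yes refl rewrite length-laneAt-appendLane ls d e = n≤1+n _
... | no  i≢d  rewrite laneAt-appendLane-≢ ls (suc d) e i i≢d = ≤-refl

size : Lanes → ℕ
size ls = sum (map length ls)

nonemptyLanes : Lanes → ℕ
nonemptyLanes []             = 0
nonemptyLanes ([] ∷ ls)      = nonemptyLanes ls
nonemptyLanes ((_ ∷ _) ∷ ls) = suc (nonemptyLanes ls)

sizeOn : Lanes → Lanes → ℕ
sizeOn ps []             = 0
sizeOn ps ([] ∷ qs)      = sizeOn (drop 1 ps) qs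
sizeOn ps ((_ ∷ _) ∷ qs) = length (laneAt ps 1) + sizeOn (drop 1 ps) qs

size-appendLane : ∀ ls d e → size (appendLane ls (suc d) e) ≡ suc (size ls)
size-appendLane []       zero    e = refl
size-appendLane []       (suc d) e = size-appendLane [] d e
size-appendLane (l ∷ ls) zero    e = cong (_+ size ls) (length-snoc l e)
size-appendLane (l ∷ ls) (suc d) e =
  trans (cong (length l +_) (size-appendLane ls d e)) (+-suc (length l) (size ls))

size-unfold : ∀ ls → size ls ≡ length (laneAt ls 1) + size (drop 1 ls)
size-unfold []       = refl
size-unfold (l ∷ ls) = refl

nonemptyLanes-appendLane-≤ : ∀ ls d e → nonemptyLanes ls ≤ nonemptyLanes (appendLane ls d e)
nonemptyLanes-appendLane-≤ ls             zero          e = ≤-refl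
nonemptyLanes-appendLane-≤ []             (suc d)       e = z≤n
nonemptyLanes-appendLane-≤ ([] ∷ ls)      (suc zero)    e = n≤1+n _
nonemptyLanes-appendLane-≤ ((_ ∷ _) ∷ ls) (suc zero)    e = ≤-refl
nonemptyLanes-appendLane-≤ ([] ∷ ls)      (suc (suc d)) e = nonemptyLanes-appendLane-≤ ls (suc d) e
nonemptyLanes-appendLane-≤ ((_ ∷ _) ∷ ls) (suc (suc d)) e = s≤s (nonemptyLanes-appendLane-≤ ls (suc d) e)

nonemptyLanes-appendLane-empty : ∀ ls d e → laneAt ls (suc d) ≡ [] →
  nonemptyLanes (appendLane ls (suc d) e) ≡ suc (nonemptyLanes ls)
nonemptyLanes-appendLane-empty []             zero    e _     = refl
nonemptyLanes-appendLane-empty []             (suc d) e _     = nonemptyLanes-appendLane-empty [] d e refl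
nonemptyLanes-appendLane-empty ([] ∷ ls)      zero    e _     = refl
nonemptyLanes-appendLane-empty ((_ ∷ _) ∷ ls) zero    e ()
nonemptyLanes-appendLane-empty ([] ∷ ls)      (suc d) e empty = nonemptyLanes-appendLane-empty ls d e empty
nonemptyLanes-appendLane-empty ((_ ∷ _) ∷ ls) (suc d) e empty =
  cong suc (nonemptyLanes-appendLane-empty ls d e empty)

size-≤ᴸ-[] : ∀ ps → ps ≤ᴸ [] → size ps ≡ 0
size-≤ᴸ-[] []       _     = refl
size-≤ᴸ-[] (l ∷ ls) ps≤[] = cong₂ _+_ (n≤0⇒n≡0 (ps≤[] 1)) (size-≤ᴸ-[] ls (≤ᴸ-drop ps≤[]))

sizeOn-≤ᴸ : ∀ ps qs → ps ≤ᴸ qs → sizeOn ps qs ≡ size ps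
sizeOn-≤ᴸ ps []             ps≤qs = sym (size-≤ᴸ-[] ps ps≤qs)
sizeOn-≤ᴸ ps ([] ∷ qs)      ps≤qs = begin
  sizeOn (drop 1 ps) qs                        ≡⟨ sizeOn-≤ᴸ (drop 1 ps) qs (≤ᴸ-drop ps≤qs) ⟩
  size (drop 1 ps)                             ≡⟨ cong (_+ size (drop 1 ps)) (n≤0⇒n≡0 (ps≤qs 1)) ⟨
  length (laneAt ps 1) + size (drop 1 ps)      ≡⟨ size-unfold ps ⟨
  size ps                                      ∎
  where open ≡-Reasoning
sizeOn-≤ᴸ ps ((_ ∷ _) ∷ qs) ps≤qs =
  trans (cong (length (laneAt ps 1) +_) (sizeOn-≤ᴸ (drop 1 ps) qs (≤ᴸ-drop ps≤qs))) (sym (size-unfold ps))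

sizeOn-mono : ∀ {ps ps′} qs → ps ≤ᴸ ps′ → sizeOn ps qs ≤ sizeOn ps′ qs
sizeOn-mono []             ps≤ps′ = z≤n
sizeOn-mono ([] ∷ qs)      ps≤ps′ = sizeOn-mono qs (≤ᴸ-drop ps≤ps′)
sizeOn-mono ((_ ∷ _) ∷ qs) ps≤ps′ = +-mono-≤ (ps≤ps′ 1) (sizeOn-mono qs (≤ᴸ-drop ps≤ps′))

OneShorter : Lanes → Lanes → Set
OneShorter ps qs = ∀ i → 1 ≤ i → Nonempty (laneAt qs i) → length (laneAt ps i) + 1 ≡ length (laneAt qs i)

oneShorter-drop : ∀ {ps} q qs → OneShorter ps (q ∷ qs) → OneShorter (drop 1 ps) qs
oneShorter-drop {ps} q qs shorter (suc d) _ nonempty =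
  subst (λ lane → length lane + 1 ≡ length (laneAt qs (suc d))) (laneAt-drop ps d)
    (shorter (suc (suc d)) (s≤s z≤n) nonempty)

sizeOn-oneShorter : ∀ ps qs → OneShorter ps qs → sizeOn ps qs + nonemptyLanes qs ≡ size qs
sizeOn-oneShorter ps []             shorter = refl
sizeOn-oneShorter ps ([] ∷ qs)      shorter =
  sizeOn-oneShorter (drop 1 ps) qs (oneShorter-drop [] qs shorter)
sizeOn-oneShorter ps ((x ∷ q) ∷ qs) shorter = begin
  (length (laneAt ps 1) + sizeOn (drop 1 ps) qs) + (1 + nonemptyLanes qs)
    ≡⟨ interchange (length (laneAt ps 1)) (sizeOn (drop 1 ps) qs) 1 (nonemptyLanes qs) ⟩
  (length (laneAt ps 1) + 1) + (sizeOn (drop 1 ps) qs + nonemptyLanes qs)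
    ≡⟨ cong₂ _+_ (shorter 1 (s≤s z≤n) (x , q , refl))
                 (sizeOn-oneShorter (drop 1 ps) qs (oneShorter-drop (x ∷ q) qs shorter)) ⟩
  suc (length q) + size qs
    ∎
  where open ≡-Reasoning

Descent : Lanes → ℕ → Set
Descent ls zero    = ⊤
Descent ls (suc d) = length (laneAt ls (suc (suc d))) < length (laneAt ls (suc d))

searchDown-descent : ∀ ls d → Descent ls (searchDown ls d)
searchDown-descent ls zero = tt
searchDown-descent ls (suc d)
  with length (laneAt ls (suc (suc d))) <ᵇ length (laneAt ls (suc d))
     | <ᵇ⇒< (length (laneAt ls (suc (suc d)))) (length (laneAt ls (suc d)))
... | true  | descends = descends tt
... | false | _        = searchDown-descent ls d

searchDown-descent-fixed : ∀ ls d → Descent ls d → searchDown ls d ≡ d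
searchDown-descent-fixed ls zero    _ = refl
searchDown-descent-fixed ls (suc d) descends
  with length (laneAt ls (suc (suc d))) <ᵇ length (laneAt ls (suc d)) | <⇒<ᵇ descends
... | true  | _  = refl
... | false | ()

laneAt-lastNonempty-empty : ∀ ls → laneAt ls (suc (lastNonempty ls)) ≡ []
laneAt-lastNonempty-empty [] = refl
laneAt-lastNonempty-empty (l ∷ ls) with lastNonempty ls | laneAt-lastNonempty-empty ls
... | suc _ | empty = empty
... | zero  | empty with l
...   | []    = refl
...   | _ ∷ _ = empty

lastNonempty-descent : ∀ ls → Descent ls (lastNonempty ls)
lastNonempty-descent [] = tt
lastNonempty-descent (l ∷ ls)
  with lastNonempty ls | lastNonempty-descent ls | laneAt-lastNonempty-empty ls
... | suc _ | descends | _     = descends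
... | zero  | _        | empty with l
...   | []     = tt
...   | _ ∷ xs = subst (λ lane → length lane < suc (length xs)) (sym empty) (s≤s z≤n)

-- If p-lane d+1 receives an entry while q-lane d+1 is not strictly longer, the two lanes have equal
-- length, so d is a descent of the q-lanes too and searchDown puts the q-entry into lane d+1 as well.
descent-transfer : ∀ {ps qs} d → Descent ps d → ps ≤ᴸ qs →
  length (laneAt qs (suc d)) ≡ length (laneAt ps (suc d)) → Descent qs d
descent-transfer zero    _        _     _    = tt
descent-transfer (suc d) descends ps≤qs same = subst (_< _) (sym same) (<-≤-trans descends (ps≤qs (suc d)))

appendLane-≤ᴸ : ∀ {ps qs} d e e′ → ps ≤ᴸ qs → Descent ps d →
  appendLane ps (suc d) e ≤ᴸ appendLane qs (suc (searchDown qs d)) e′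
appendLane-≤ᴸ {ps} {qs} d e e′ ps≤qs descends i with i ≟ suc d
... | no i≢d rewrite laneAt-appendLane-≢ ps (suc d) e i i≢d =
  ≤-trans (ps≤qs i) (appendLane-grows qs (suc (searchDown qs d)) e′ i)
... | yes refl rewrite length-laneAt-appendLane ps d e with m≤n⇒m<n∨m≡n (ps≤qs (suc d))
...   | inj₁ shorter = ≤-trans shorter (appendLane-grows qs (suc (searchDown qs d)) e′ (suc d))
...   | inj₂ same
        rewrite searchDown-descent-fixed qs d (descent-transfer d descends ps≤qs (sym same))
              | length-laneAt-appendLane qs d e′ = s≤s (≤-reflexive same)

StartsWith : (Entry → Set) → Lanes → Set
StartsWith P ls = ∃[ d ] ∃[ e ] ∃[ rest ] laneAt ls d ≡ e ∷ rest × P e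

startsWith-appendLane : ∀ {P} ls d e → StartsWith P (appendLane ls (suc d) e) →
  StartsWith P ls ⊎ (laneAt ls (suc d) ≡ [] × P e)
startsWith-appendLane ls d e (i , x , rest , lane , px) with i ≟ suc d
... | no i≢d = inj₁ (i , x , rest , trans (sym (laneAt-appendLane-≢ ls (suc d) e i i≢d)) lane , px)
... | yes refl with laneAt ls (suc d) in old | trans (sym (laneAt-appendLane-≡ ls d e)) lane
...   | []     | refl = inj₂ (refl , px)
...   | y ∷ ys | refl = inj₁ (suc d , y , ys , old , px)

PairedAppend : Lanes → Lanes → Lanes → Lanes → Set
PairedAppend ps qs ps′ qs′ = ∃[ d ] Descent ps d × ∃[ e ] ∃[ e′ ]
  ps′ ≡ appendLane ps (suc d) e × qs′ ≡ appendLane qs (suc (searchDown qs d)) e′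

-- Each q-entry either opens a new lane or is paired with a p-entry; a lane opened by a paired entry
-- makes the bound strict.
record Balanced (P : Entry → Set) (ps qs : Lanes) : Set where
  field
    dominated : ps ≤ᴸ qs
    size-≤    : size qs ≤ size ps + nonemptyLanes qs
    size-<    : StartsWith P qs → size qs < size ps + nonemptyLanes qs
open Balanced

balanced-[] : ∀ {P} → Balanced P [] []
balanced-[] = record
  { dominated = ≤ᴸ-refl
  ; size-≤    = z≤n
  ; size-<    = λ { (zero , _ , _ , () , _) ; (suc _ , _ , _ , () , _) }
  }

pairedAppend-balanced : ∀ {P ps qs ps′ qs′} → Balanced P ps qs → PairedAppend ps qs ps′ qs′ →
  Balanced P ps′ qs′
pairedAppend-balanced {P} {ps} {qs} bal (d , descends , e , e′ , refl , refl) = record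
  { dominated = appendLane-≤ᴸ d e e′ (dominated bal) descends
  ; size-≤    = size-≤′
  ; size-<    = size-<′
  }
  where
  D = searchDown qs d
  ps′ = appendLane ps (suc d) e
  qs′ = appendLane qs (suc D) e′
  more-lanes : size ps + nonemptyLanes qs ≤ size ps + nonemptyLanes qs′
  more-lanes = +-monoʳ-≤ (size ps) (nonemptyLanes-appendLane-≤ qs (suc D) e′)
  size-≤′ : size qs′ ≤ size ps′ + nonemptyLanes qs′
  size-≤′ rewrite size-appendLane qs D e′ | size-appendLane ps d e = s≤s (≤-trans (size-≤ bal) more-lanes)
  size-<′ : StartsWith P qs′ → size qs′ < size ps′ + nonemptyLanes qs′
  size-<′ starts with startsWith-appendLane qs D e′ starts
  ... | inj₁ old rewrite size-appendLane qs D e′ | size-appendLane ps d e =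
    s≤s (≤-trans (size-< bal old) more-lanes)
  ... | inj₂ (empty , _)
    rewrite size-appendLane qs D e′ | size-appendLane ps d e
          | nonemptyLanes-appendLane-empty qs D e′ empty | +-suc (size ps) (nonemptyLanes qs) =
    s≤s (s≤s (size-≤ bal))

openLane-balanced : ∀ {P ps qs} e → ¬ P e → Balanced P ps qs →
  Balanced P ps (appendLane qs (suc (lastNonempty qs)) e)
openLane-balanced {P} {ps} {qs} e ¬pe bal = record
  { dominated = ≤ᴸ-trans (dominated bal) (appendLane-grows qs _ e)
  ; size-≤    = size-≤′
  ; size-<    = size-<′
  }
  where
  D = lastNonempty qs
  qs′ = appendLane qs (suc D) e
  empty = laneAt-lastNonempty-empty qs
  size-≤′ : size qs′ ≤ size ps + nonemptyLanes qs′
  size-≤′ rewrite size-appendLane qs D e | nonemptyLanes-appendLane-empty qs D e empty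
                | +-suc (size ps) (nonemptyLanes qs) = s≤s (size-≤ bal)
  size-<′ : StartsWith P qs′ → size qs′ < size ps + nonemptyLanes qs′
  size-<′ starts with startsWith-appendLane qs D e starts
  ... | inj₁ old
    rewrite size-appendLane qs D e | nonemptyLanes-appendLane-empty qs D e empty
          | +-suc (size ps) (nonemptyLanes qs) = s≤s (size-< bal old)
  ... | inj₂ (_ , pe) = ⊥-elim (¬pe pe)

balanced-oneShorter-contradiction : ∀ {P ps qs ps′} → Balanced P ps qs → ps ≤ᴸ ps′ → OneShorter ps′ qs →
  ¬ StartsWith P qs
balanced-oneShorter-contradiction {P} {ps} {qs} {ps′} bal grows shorter starts = <-irrefl refl (begin-strict
  size qs                            <⟨ size-< bal starts ⟩
  size ps + nonemptyLanes qs         ≡⟨ cong (_+ nonemptyLanes qs) (sizeOn-≤ᴸ ps qs (dominated bal)) ⟨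
  sizeOn ps qs + nonemptyLanes qs    ≤⟨ +-monoˡ-≤ (nonemptyLanes qs) (sizeOn-mono qs grows) ⟩
  sizeOn ps′ qs + nonemptyLanes qs   ≡⟨ sizeOn-oneShorter ps′ qs shorter ⟩
  size qs                            ∎)
  where open ≤-Reasoning

update-≡ : ∀ st v ls → update st v ls v ≡ ls
update-≡ st v ls with v ≡ᵇ v | ≡⇒≡ᵇ v v refl
... | true  | _  = refl
... | false | ()

update-≢ : ∀ st v ls w → w ≢ v → update st v ls w ≡ st w
update-≢ st v ls w w≢v with w ≡ᵇ v | ≡ᵇ⇒≡ w v
... | true  | w≡v = ⊥-elim (w≢v (w≡v tt))
... | false | _   = refl

update-appendLane-grows : ∀ st v d e w → st w ≤ᴸ update st v (appendLane (st v) d e) w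
update-appendLane-grows st v d e w with w ≟ v
... | yes refl rewrite update-≡ st w (appendLane (st w) d e) = appendLane-grows (st w) d e
... | no  w≢v  rewrite update-≢ st v (appendLane (st v) d e) w w≢v = ≤ᴸ-refl

processRest-below : ∀ b r k v d st w → w < v → processRest b r k v d st w ≡ st w
processRest-below b zero    k v d st w w<v = refl
processRest-below b (suc r) k v d st w w<v =
  trans (processRest-below b r (suc k) (suc v) _ _ w (m<n⇒m<1+n w<v)) (update-≢ st v _ w (<⇒≢ w<v))

processRest-above : ∀ b r k v d st w → v + r ≤ w → processRest b r k v d st w ≡ st w
processRest-above b zero    k v d st w _      = refl
processRest-above b (suc r) k v d st w v+r≤w =
  trans (processRest-above b r (suc k) (suc v) _ _ w (subst (_≤ w) (+-suc v r) v+r≤w))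
        (update-≢ st v _ w (>⇒≢ (<-≤-trans (m<m+n v z<s) v+r≤w)))

processRest-grows : ∀ b r k v d st w → st w ≤ᴸ processRest b r k v d st w
processRest-grows b zero    k v d st w = ≤ᴸ-refl
processRest-grows b (suc r) k v d st w =
  ≤ᴸ-trans (update-appendLane-grows st v _ (b , k) w) (processRest-grows b r (suc k) (suc v) _ _ w)

processRest-first : ∀ b r k v d st →
  processRest b (suc r) k v d st v ≡ appendLane (st v) (suc (searchDown (st v) d)) (b , k)
processRest-first b r k v d st =
  trans (processRest-below b r (suc k) (suc v) _ _ v (n<1+n v)) (update-≡ st v _)

processRest-pairs-here : ∀ p b r k d st →
  PairedAppend (st p) (st (suc p))
    (processRest b (suc (suc r)) k p d st p) (processRest b (suc (suc r)) k p d st (suc p))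
processRest-pairs-here p b r k d st =
  d′ , searchDown-descent (st p) d , (b , k) , (b , suc k) ,
  processRest-first b (suc r) k p d st ,
  trans (processRest-first b r (suc k) (suc p) d′ st₁)
        (cong (λ ls → appendLane ls (suc (searchDown ls d′)) (b , suc k)) (update-≢ st p A (suc p) 1+n≢n))
  where
  d′ = searchDown (st p) d
  A = appendLane (st p) (suc d′) (b , k)
  st₁ = update st p A

processRest-pairs : ∀ p b r k v d st → v ≤ p → suc p < v + r →
  PairedAppend (st p) (st (suc p)) (processRest b r k v d st p) (processRest b r k v d st (suc p))
processRest-pairs p b zero k v d st v≤p p<v =
  ⊥-elim (<⇒≱ (subst (suc p <_) (+-identityʳ v) p<v) (≤-trans v≤p (n≤1+n p)))
processRest-pairs p b (suc r) k v d st v≤p p<v+r with v ≟ p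
processRest-pairs p b (suc zero)    k v d st v≤p p<v+r | yes refl =
  ⊥-elim (<-irrefl (sym (+-comm v 1)) p<v+r)
processRest-pairs p b (suc (suc r)) k v d st v≤p p<v+r | yes refl = processRest-pairs-here v b r k d st
... | no v≢p =
  subst₂ (λ ps qs → PairedAppend ps qs (rest p) (rest (suc p)))
    (update-≢ st v A p (v≢p ∘ sym)) (update-≢ st v A (suc p) (>⇒≢ (s≤s v≤p)))
    (processRest-pairs p b r (suc k) (suc v) d′ st₁ (≤∧≢⇒< v≤p v≢p) (subst (suc p <_) (+-suc v r) p<v+r))
  where
  d′ = searchDown (st v) d
  A = appendLane (st v) (suc d′) (b , k)
  st₁ = update st v A
  rest = processRest b r (suc k) (suc v) d′ st₁

processInterval-grows : ∀ b I st w → st w ≤ᴸ processInterval b I st w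
processInterval-grows b (a , m) st w =
  ≤ᴸ-trans (update-appendLane-grows st a _ (b , 0) w) (processRest-grows b (m ∸ a) 1 (suc a) _ _ w)

processInterval-below : ∀ b a m st w → w < a → processInterval b (a , m) st w ≡ st w
processInterval-below b a m st w w<a =
  trans (processRest-below b (m ∸ a) 1 (suc a) _ _ w (m<n⇒m<1+n w<a)) (update-≢ st a _ w (<⇒≢ w<a))

processInterval-above : ∀ b a m st w → a ≤ m → m < w → processInterval b (a , m) st w ≡ st w
processInterval-above b a m st w a≤m m<w =
  trans (processRest-above b (m ∸ a) 1 (suc a) _ _ w (subst (_≤ w) (cong suc (sym (m+[n∸m]≡n a≤m))) m<w))
        (update-≢ st a _ w (>⇒≢ (≤-<-trans a≤m m<w)))

processInterval-head : ∀ b a m st →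
  processInterval b (a , m) st a ≡ appendLane (st a) (suc (lastNonempty (st a))) (b , 0)
processInterval-head b a m st =
  trans (processRest-below b (m ∸ a) 1 (suc a) _ _ a (n<1+n a)) (update-≡ st a _)

processInterval-pairs-here : ∀ p b m st → p < m →
  PairedAppend (st p) (st (suc p)) (processInterval b (p , m) st p) (processInterval b (p , m) st (suc p))
processInterval-pairs-here p b (suc m) st (s≤s p≤m) rewrite +-∸-assoc 1 p≤m =
  d₁ , lastNonempty-descent (st p) , (b , 0) , (b , 1) ,
  trans (processRest-below b (suc (m ∸ p)) 1 (suc p) d₁ st₁ p (n<1+n p)) (update-≡ st p A) ,
  trans (processRest-first b (m ∸ p) 1 (suc p) d₁ st₁)
        (cong (λ ls → appendLane ls (suc (searchDown ls d₁)) (b , 1)) (update-≢ st p A (suc p) 1+n≢n))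
  where
  d₁ = lastNonempty (st p)
  A = appendLane (st p) (suc d₁) (b , 0)
  st₁ = update st p A

processInterval-pairs : ∀ p b a m st → a ≤ p → p < m →
  PairedAppend (st p) (st (suc p)) (processInterval b (a , m) st p) (processInterval b (a , m) st (suc p))
processInterval-pairs p b a m st a≤p p<m with m≤n⇒m<n∨m≡n a≤p
... | inj₂ refl = processInterval-pairs-here p b m st p<m
... | inj₁ a<p =
  subst₂ (λ ps qs → PairedAppend ps qs (rest p) (rest (suc p)))
    (update-≢ st a A p (>⇒≢ a<p)) (update-≢ st a A (suc p) (>⇒≢ (m<n⇒m<1+n a<p)))
    (processRest-pairs p b (m ∸ a) 1 (suc a) d₁ st₁ a<p
      (subst (suc p <_) (cong suc (sym (m+[n∸m]≡n (≤-trans a≤p (<⇒≤ p<m))))) (s≤s p<m)))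
  where
  d₁ = lastNonempty (st a)
  A = appendLane (st a) (suc d₁) (b , 0)
  st₁ = update st a A
  rest = processRest b (m ∸ a) 1 (suc a) d₁ st₁

processFrom-grows : ∀ β b st w → st w ≤ᴸ processFrom b β st w
processFrom-grows []      b st w = ≤ᴸ-refl
processFrom-grows (I ∷ β) b st w =
  ≤ᴸ-trans (processInterval-grows b I st w) (processFrom-grows β (suc b) (processInterval b I st) w)

processFrom-above : ∀ β b st w → All (λ I → proj₁ I ≤ proj₂ I) β → All (λ I → proj₂ I < w) β →
  processFrom b β st w ≡ st w
processFrom-above []            b st w []          []          = refl
processFrom-above ((a , m) ∷ β) b st w (a≤m ∷ ok) (m<w ∷ below) =
  trans (processFrom-above β (suc b) (processInterval b (a , m) st) w ok below)
        (processInterval-above b a m st w a≤m m<w)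

endpoints-below : ∀ {I β x} → Linked CascOrder (I ∷ β) → proj₂ I < x → All (λ J → proj₂ J < x) (I ∷ β)
endpoints-below [-]                  m<x = m<x ∷ []
endpoints-below ((m′≤m , _) ∷ sorted) m<x = m<x ∷ endpoints-below sorted (≤-<-trans m′≤m m<x)

module PlateauArgument (α : Seq) (p : ℕ) where

  q : ℕ
  q = suc p

  LowHead : Entry → Set
  LowHead (b , _) = ∃[ a ] ∃[ m ] nth b α ≡ just (a , m) × a < q

  BalancedState : State → Set
  BalancedState st = Balanced LowHead (st p) (st q)

  balancedState-step : ∀ b a m st → nth b α ≡ just (a , m) → q ≤ m →
    BalancedState st → BalancedState (processInterval b (a , m) st)
  balancedState-step b a m st nb q≤m bal with <-cmp a q
  ... | tri< (s≤s a≤p) _ _ = pairedAppend-balanced bal (processInterval-pairs p b a m st a≤p q≤m)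
  ... | tri≈ _ refl _ =
    subst₂ (Balanced LowHead)
      (sym (processInterval-below b q m st p (n<1+n p))) (sym (processInterval-head b q m st))
      (openLane-balanced (b , 0) not-low bal)
    where
    not-low : ¬ LowHead (b , 0)
    not-low (_ , _ , nb′ , a<q) with trans (sym nb) nb′
    ... | refl = <-irrefl refl a<q
  ... | tri> _ _ q<a =
    subst₂ (Balanced LowHead) (sym (processInterval-below b a m st p (<-trans (n<1+n p) q<a)))
      (sym (processInterval-below b a m st q q<a)) bal

  SuffixAt : ℕ → Seq → Set
  SuffixAt b β = ∀ i → nth i β ≡ nth (b + i) α

  -- Once an interval ends below q, so do all later ones: from then on the q-lanes are final and
  -- the p-lanes only grow.
  balanced-prefix : ∀ {n} β b st → SuffixAt b β → Linked CascOrder β → All (ValidInterval n) β →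
    BalancedState st →
    ∃[ mid ] BalancedState mid × processFrom b β st q ≡ mid q × mid p ≤ᴸ processFrom b β st p
  balanced-prefix []            b st _      _      _     bal = st , bal , refl , ≤ᴸ-refl
  balanced-prefix ((a , m) ∷ β) b st suffix sorted valid bal with q ≤? m
  ... | yes q≤m =
    balanced-prefix β (suc b) (processInterval b (a , m) st) suffix′ (Linked.tail sorted) (All.tail valid)
      (balancedState-step b a m st nb q≤m bal)
    where
    nb : nth b α ≡ just (a , m)
    nb = trans (cong (λ c → nth c α) (sym (+-identityʳ b))) (sym (suffix 0))
    suffix′ : SuffixAt (suc b) β
    suffix′ i = trans (suffix (suc i)) (cong (λ c → nth c α) (+-suc b i))
  ... | no q≰m =
    st , bal ,
    processFrom-above ((a , m) ∷ β) b st q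
      (All.map (proj₁ ∘ proj₂) valid) (endpoints-below sorted (≰⇒> q≰m)) ,
    processFrom-grows ((a , m) ∷ β) b st p

  no-low-head-start : ∀ {n} → Cascading n α → OneShorter (lanesOf α p) (lanesOf α q) →
    ¬ StartsWith LowHead (lanesOf α q)
  no-low-head-start (valid , sorted) shorter starts
    with balanced-prefix α 0 emptyState (λ _ → refl) sorted valid balanced-[]
  ... | mid , bal , q-final , p-grows =
    balanced-oneShorter-contradiction bal p-grows
      (subst (OneShorter _) q-final shorter) (subst (StartsWith LowHead) q-final starts)

mainTheorem10 : (n l : ℕ) → 2 ≤ l → l ≤ n → (α : Seq) → Cascading n α → Plateau α l →
    ∀ d b k (rest : List Entry) → laneAt (lanesOf α l) d ≡ (b , k) ∷ rest →
    ∀ a m → nth b α ≡ just (a , m) → ¬ (a < l)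
mainTheorem10 n zero    ()
mainTheorem10 n (suc p) _ _ α cascading (shorter , _) d b k rest lane a m nb a<l =
  PlateauArgument.no-low-head-start α p cascading shorter (d , (b , k) , rest , lane , a , m , nb , a<l)
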